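{- For a linear order $L$, the following are equivalent: (1) $L\to(\mathbb Z,\mathbb Z)^1$, i.e., for every partition $L=A\cup B$ into two pieces, $A$ or $B$ contains a suborder isomorphic to $(\mathbb Z,<)$; (2) $L\to(\omega,\omega^*)^1$, i.e., for every partition $L=A\cup B$, either $A$ contains a suborder isomorphic to $\omega$ or $B$ contains a suborder isomorphic to $\omega^*$; (3) $L$ contains a suborder isomorphic to $\omega\cdot\omega^*$ or a suborder isomorphic to $\omega^*\cdot\omega$.
   Context: All orders are linear orders; a suborder of $(X,<)$ is a subset $Y\subseteq X$ with the restricted order, and "contains a copy of" means "has a suborder isomorphic to". $\omega$ denotes the order type of $(\mathbb N,<)$ and $\omega^*$ the order type of the negative integers (i.e., $\mathbb N$ with reversed order). For linear orders $A,B$, the product $A\cdot B$ is the order obtained by starting with $B$ and replacing each point of $B$ by a copy of $A$; concretely, it is $B\times A$ ordered by $(b,a)<(b',a')$ iff $b<b'$ in $B$, or $b=b'$ and $a<a'$ in $A$. Thus $\omega\cdot\omega^*$ is an $\omega^*$-indexed descending sequence of copies of $\omega$, and $\omega^*\cdot\omega$ is an $\omega$-indexed sequence of copies of $\omega^*$. For linear orders $L,\ell_1,\ell_2$, $L\to(\ell_1,\ell_2)^1$ means that for every partition $L=A_1\cup A_2$, $A_1$ contains a copy of $\ell_1$ or $A_2$ contains a copy of $\ell_2$. -}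

module Defs where

open import Level using (Level; _⊔_; 0ℓ)
open import Data.Product using (Σ; _×_)
open import Data.Empty using (⊥)
open import Data.Sum using (_⊎_)
open import Relation.Unary using (Pred; U)
open import Relation.Binary.Bundles using (StrictTotalOrder)
open import Function.Bundles using (_⇔_)
import Data.Nat.Properties as ℕP
import Data.Integer.Properties as ℤP
import Relation.Binary.Construct.Flip.EqAndOrd as Flip
open import Data.Product.Relation.Binary.Lex.Strict using (×-strictTotalOrder)

LinOrd : Set₁
LinOrd = StrictTotalOrder 0ℓ 0ℓ 0ℓ

ω : LinOrd
ω = ℕP.<-strictTotalOrder

ω* : LinOrd
ω* = Flip.strictTotalOrder ℕP.<-strictTotalOrder

ℤ< : LinOrd
ℤ< = ℤP.<-strictTotalOrder

-- Product A · B : B × A ordered lexicographically, B-coordinate first.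
_·_ : LinOrd → LinOrd → LinOrd
A · B = ×-strictTotalOrder B A

CopyIn : ∀ {c ℓ₁ ℓ₂ p} (M : LinOrd) (L : StrictTotalOrder c ℓ₁ ℓ₂)
         → Pred (StrictTotalOrder.Carrier L) p → Set (c ⊔ ℓ₂ ⊔ p)
CopyIn M L S =
  Σ (M.Carrier → L.Carrier) λ f →
    (∀ x → S (f x)) ×
    (∀ x y → (x M.< y) ⇔ (f x L.< f y))
  where
    module M = StrictTotalOrder M
    module L = StrictTotalOrder L

Contains : ∀ {c ℓ₁ ℓ₂} (M : LinOrd) (L : StrictTotalOrder c ℓ₁ ℓ₂) → Set (c ⊔ ℓ₂)
Contains M L = CopyIn M L (U {A = StrictTotalOrder.Carrier L})

IsPartition : ∀ {c ℓ₁ ℓ₂ p} (L : StrictTotalOrder c ℓ₁ ℓ₂)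
              → (A B : Pred (StrictTotalOrder.Carrier L) p) → Set (c ⊔ p)
IsPartition L A B = (∀ x → A x ⊎ B x) × (∀ x → A x → B x → ⊥)

Arrow : ∀ {c ℓ₁ ℓ₂} (p : Level) (L : StrictTotalOrder c ℓ₁ ℓ₂) (M N : LinOrd)
        → Set (c ⊔ ℓ₂ ⊔ Level.suc p)
Arrow p L M N =
  ∀ (A B : Pred (StrictTotalOrder.Carrier L) p) → IsPartition L A B →
    CopyIn M L A ⊎ CopyIn N L B

-- (1) ⇒ (2): restrict a copy of ℤ to its negative and its positive half.
--
-- (3) ⇒ (1): colour a copy of ω*·ω. By the infinite pigeonhole principle, infinitely many of its
-- ω*-rows contain infinitely many points of one colour. A descending sequence of that colour in
-- one such row, followed by one point of that colour from each later such row, is a copy of ℤ.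
-- Copies of ω·ω* are copies of ω*·ω in the reversed order.
--
-- (2) ⇒ (3): call S ⊆ L splittable if S ⊆ W ∪ V where W contains no ω* and V no ω. By pigeonhole,
-- splittable sets are closed under finite unions, and colouring V against its complement shows
-- that a splittable L refutes (2). So it suffices to show that L is splittable if it contains
-- neither ω*·ω nor ω·ω*. Given S, the points y with S ∩ (−∞, y] splittable form a splittable set:
-- otherwise each of them has a descending sequence of such points above it, and these sequences
-- stack up to an ω*·ω. Dually for [y, ∞). Hence a non-splittable S has a point m with both
-- S ∩ (−∞, m] and S ∩ [m, ∞) non-splittable; iterating on S ∩ [m, ∞) and taking a descending
-- sequence in each S ∩ (−∞, m] again stacks up to an ω*·ω.

module Submission where

open import Defs
open import Level using (Level; _⊔_; Lift; lift; lower) renaming (suc to lsuc)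
open import Data.Nat as ℕ using (ℕ; zero; suc; _<′_; <′-base; <′-step; z<s)
open import Data.Nat.Properties using (n<1+n; ≤-refl; <⇒<′; <-trans)
open import Data.Nat.InfinitelyOften using (Fin; _∪-Fin_)
open import Data.Integer as ℤ using (ℤ; +_; -[1+_]; -<-; -<+; +<+)
open import Data.Product using (Σ; ∃; _×_; _,_; proj₁; proj₂; uncurry; map₁)
open import Data.Sum using (_⊎_; inj₁; inj₂; [_,_]′)
import Data.Sum as Sum
open import Data.Empty using (⊥; ⊥-elim)
open import Data.Unit.Polymorphic using (tt)
open import Function using (_∘_; flip; id)
open import Function.Bundles using (_⇔_; mk⇔; module Equivalence)
open Equivalence using (to; from)
open import Function.Construct.Composition using (_⇔-∘_)
open import Function.Construct.Symmetry using (⇔-sym)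
open import Relation.Binary.Core using (Rel; _Preserves_⟶_)
open import Relation.Binary.Definitions using (Transitive; tri<; tri≈; tri>)
open import Relation.Binary.Bundles using (StrictTotalOrder)
open import Relation.Binary.PropositionalEquality using (refl; sym)
import Relation.Binary.Construct.Flip.EqAndOrd as Flip
open import Relation.Nullary using (¬_; yes; no)
open import Relation.Nullary.Decidable using (True; False; toWitness; toWitnessFalse)
open import Relation.Unary using (Pred; _⊆_; _∪_; _∩_; Satisfiable; U)
import Relation.Unary.Polymorphic as Poly
open import Axiom.ExcludedMiddle using (ExcludedMiddle)
open import Axiom.DoubleNegationElimination using (em⇒dne)

private
  variable
    a p q r s : Level
    X : Set a
    P Q : Pred X p
    R : Rel X r

Unbounded : Pred ℕ p → Set p
Unbounded P = ∀ i → ∃ λ j → i ℕ.≤ j × P j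

record Chain {X : Set a} (R : Rel X r) (P : Pred X p) : Set (a ⊔ r ⊔ p) where
  constructor chain
  field
    term  : ℕ → X
    term∈ : ∀ n → P (term n)
    step  : ∀ n → R (term n) (term (suc n))

open Chain

chain-map : P ⊆ Q → Chain R P → Chain R Q
chain-map P⊆Q (chain f f∈P f-step) = chain f (P⊆Q ∘ f∈P) f-step

chain-mono : Transitive R → (c : Chain R P) → ∀ {m n} → m ℕ.< n → R (term c m) (term c n)
chain-mono {R = R} trans c = go ∘ <⇒<′
  where
  go : ∀ {m n} → m <′ n → R (term c m) (term c n)
  go <′-base        = step c _
  go (<′-step m<n)  = trans (go m<n) (step c _)

unbounded⇒ascending : Unbounded P → Chain ℕ._<_ P
unbounded⇒ascending unbounded =
  chain (proj₁ ∘ unbounded ∘ searchFrom) (proj₂ ∘ proj₂ ∘ unbounded ∘ searchFrom)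
        (proj₁ ∘ proj₂ ∘ unbounded ∘ searchFrom ∘ suc)
  where
  searchFrom : ℕ → ℕ
  searchFrom zero    = zero
  searchFrom (suc n) = suc (proj₁ (unbounded (searchFrom n)))

subchain : Transitive R → (c : Chain R P) → Unbounded (Q ∘ term c) → Chain R Q
subchain trans c unbounded =
  let chain index Q-index index-step = unbounded⇒ascending unbounded
  in chain (term c ∘ index) Q-index (chain-mono trans c ∘ index-step)

record Splittable {X : Set a} (_<_ : Rel X r) (S : Pred X s) : Set (a ⊔ r ⊔ lsuc s) where
  field
    W V            : Pred X s
    cover          : S ⊆ W ∪ V
    W-noDescending : ¬ Chain (flip _<_) W
    V-noAscending  : ¬ Chain _<_ V

splittable-flip : {S : Pred X s} → Splittable R S → Splittable (flip R) S
splittable-flip split = record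
  { W = V ; V = W ; cover = Sum.swap ∘ cover
  ; W-noDescending = V-noAscending ; V-noAscending = W-noDescending }
  where open Splittable split

splittable-⊆ : {S T : Pred X s} → S ⊆ T → Splittable R T → Splittable R S
splittable-⊆ S⊆T split = record
  { W = W ; V = V ; cover = cover ∘ S⊆T
  ; W-noDescending = W-noDescending ; V-noAscending = V-noAscending }
  where open Splittable split

¬descending⇒splittable : {S : Pred X s} → ¬ Chain (flip R) S → Splittable R S
¬descending⇒splittable ¬descending = record
  { W = _ ; V = Poly.∅ ; cover = inj₁
  ; W-noDescending = ¬descending ; V-noAscending = λ c → lower (term∈ c 0) }

module Classical (lem : ∀ {ℓ} → ExcludedMiddle ℓ) where

  dne : ∀ {ℓ} {A : Set ℓ} → ¬ ¬ A → A
  dne = em⇒dne lem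

  ¬unbounded⇒fin : ¬ Unbounded P → Fin P
  ¬unbounded⇒fin ¬unbounded = dne λ ¬fin → ¬unbounded λ i →
    dne λ ¬later → ¬fin (i , λ j i≤j Pj → ¬later (j , i≤j , Pj))

  unbounded-⊎ : (∀ k → P k ⊎ Q k) → Unbounded P ⊎ Unbounded Q
  unbounded-⊎ P∪Q = dne λ neither →
    let (i , never) = ¬unbounded⇒fin (neither ∘ inj₁) ∪-Fin ¬unbounded⇒fin (neither ∘ inj₂)
    in never i ≤-refl (P∪Q i)

  ¬chain-∪ : Transitive R → ¬ Chain R P → ¬ Chain R Q → ¬ Chain R (P ∪ Q)
  ¬chain-∪ trans ¬P ¬Q c =
    [ ¬P ∘ subchain trans c , ¬Q ∘ subchain trans c ]′ (unbounded-⊎ (term∈ c))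

  splittable-∪ : {S T : Pred X s} → Transitive R →
                 Splittable R S → Splittable R T → Splittable R (S ∪ T)
  splittable-∪ trans split₁ split₂ = record
    { W = S₁.W ∪ S₂.W ; V = S₁.V ∪ S₂.V
    ; cover = [ Sum.map inj₁ inj₁ ∘ S₁.cover , Sum.map inj₂ inj₂ ∘ S₂.cover ]′
    ; W-noDescending = ¬chain-∪ (flip trans) S₁.W-noDescending S₂.W-noDescending
    ; V-noAscending  = ¬chain-∪ trans S₁.V-noAscending S₂.V-noAscending }
    where
    module S₁ = Splittable split₁
    module S₂ = Splittable split₂

  ¬splittable⇒descending : {S : Pred X s} → ¬ Splittable R S → Chain (flip R) S
  ¬splittable⇒descending ¬split = dne (¬split ∘ ¬descending⇒splittable)

strictMono⇒copyIn : ∀ {c ℓ₁ ℓ₂} (M : LinOrd) (L : StrictTotalOrder c ℓ₁ ℓ₂)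
  {P : Pred (StrictTotalOrder.Carrier L) p}
  (f : StrictTotalOrder.Carrier M → StrictTotalOrder.Carrier L) → (∀ x → P (f x)) →
  f Preserves StrictTotalOrder._≈_ M ⟶ StrictTotalOrder._≈_ L →
  f Preserves StrictTotalOrder._<_ M ⟶ StrictTotalOrder._<_ L →
  CopyIn M L P
strictMono⇒copyIn M L f f∈P f-cong f-mono = f , f∈P , λ x y → mk⇔ f-mono (reflect x y)
  where
  module M = StrictTotalOrder M
  module L = StrictTotalOrder L
  reflect : ∀ x y → f x L.< f y → x M.< y
  reflect x y fx<fy with M.compare x y
  ... | tri< x<y _ _ = x<y
  ... | tri≈ _ x≈y _ = ⊥-elim (L.irrefl (f-cong x≈y) fx<fy)
  ... | tri> _ _ y<x = ⊥-elim (L.asym fx<fy (f-mono y<x))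

module Shapes {c ℓ₁ ℓ₂} (L : StrictTotalOrder c ℓ₁ ℓ₂) where
  open StrictTotalOrder L

  Ascending Descending : Pred Carrier p → Set (c ⊔ ℓ₂ ⊔ p)
  Ascending  = Chain _<_
  Descending = Chain _>_

  >-trans : Transitive _>_
  >-trans = flip trans

  AtMost AtLeast Above : Carrier → Pred Carrier ℓ₂
  AtMost  y x = ¬ (y < x)
  AtLeast y x = ¬ (x < y)
  Above   y x = y < x

  ≮-<-trans : ∀ {x y z} → ¬ (y < x) → y < z → x < z
  ≮-<-trans {x} {y} y≮x y<z with compare x y
  ... | tri< x<y _ _ = trans x<y y<z
  ... | tri≈ _ x≈y _ = <-respˡ-≈ (Eq.sym x≈y) y<z
  ... | tri> _ _ y<x = ⊥-elim (y≮x y<x)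

  copyIn-ω⇔ascending : CopyIn ω L P ⇔ Ascending P
  copyIn-ω⇔ascending {P = P} = mk⇔
    (λ (f , f∈P , iso) → chain f f∈P λ n → to (iso n (suc n)) (n<1+n n))
    (λ a → strictMono⇒copyIn ω L {P = P} (term a) (term∈ a) (λ { refl → Eq.refl })
                              (chain-mono trans a))

  copyIn-ω*⇔descending : CopyIn ω* L P ⇔ Descending P
  copyIn-ω*⇔descending {P = P} = mk⇔
    (λ (f , f∈P , iso) → chain f f∈P λ n → to (iso (suc n) n) (n<1+n n))
    (λ d → strictMono⇒copyIn ω* L {P = P} (term d) (term∈ d) (λ { refl → Eq.refl })
                              (chain-mono >-trans d))

  record ZShape (P : Pred Carrier p) : Set (c ⊔ ℓ₂ ⊔ p) where
    field
      negative          : Descending P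
      positive          : Ascending P
      negative<positive : ∀ i j → term negative i < term positive j

  copyIn-ℤ⇔zShape : CopyIn ℤ< L P ⇔ ZShape P
  copyIn-ℤ⇔zShape {P = P} = mk⇔ zShape copy
    where
    zShape : CopyIn ℤ< L P → ZShape P
    zShape (f , f∈P , iso) = record
      { negative          = chain (f ∘ -[1+_]) (f∈P ∘ -[1+_]) λ n → to (iso _ _) (-<- (n<1+n n))
      ; positive          = chain (f ∘ +_) (f∈P ∘ +_) λ n → to (iso _ _) (+<+ (n<1+n n))
      ; negative<positive = λ i j → to (iso _ _) -<+ }
    copy : ZShape P → CopyIn ℤ< L P
    copy z = strictMono⇒copyIn ℤ< L {P = P} f f∈P (λ { refl → Eq.refl }) f-mono
      where
      open ZShape z
      f : ℤ → Carrier
      f -[1+ n ] = term negative n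
      f (+ n)    = term positive n
      f∈P : ∀ i → P (f i)
      f∈P -[1+ n ] = term∈ negative n
      f∈P (+ n)    = term∈ positive n
      f-mono : f Preserves ℤ._<_ ⟶ _<_
      f-mono (-<- n<m) = chain-mono >-trans negative n<m
      f-mono -<+       = negative<positive _ _
      f-mono (+<+ m<n) = chain-mono trans positive m<n

  record ω*·ωShape : Set (c ⊔ ℓ₂) where
    field
      point      : ℕ → ℕ → Carrier
      descending : ∀ n k → point n (suc k) < point n k
      below-next : ∀ n k → point n 0 < point (suc n) k

    row : ℕ → Descending U
    row n = chain (point n) _ (descending n)

    within : ∀ n {k k′} → k ℕ.< k′ → point n k′ < point n k
    within n = chain-mono >-trans (row n)

    below-later : ∀ {n n′} → n ℕ.< n′ → ∀ k → point n 0 < point n′ k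
    below-later {n} = go ∘ <⇒<′
      where
      go : ∀ {n′} → n <′ n′ → ∀ k → point n 0 < point n′ k
      go <′-base        k = below-next n k
      go (<′-step n<n′) k = trans (go n<n′ 0) (below-next _ k)

    cross : ∀ {n n′} → n ℕ.< n′ → ∀ k k′ → point n k < point n′ k′
    cross n<n′ zero    k′ = below-later n<n′ k′
    cross n<n′ (suc k) k′ = trans (within _ z<s) (below-later n<n′ k′)

  contains-ω*·ω⇔ω*·ωShape : Contains (ω* · ω) L ⇔ ω*·ωShape
  contains-ω*·ω⇔ω*·ωShape = mk⇔ shape copy
    where
    shape : Contains (ω* · ω) L → ω*·ωShape
    shape (f , _ , iso) = record
      { point      = λ n k → f (n , k)
      ; descending = λ n k → to (iso _ _) (inj₂ (refl , n<1+n k))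
      ; below-next = λ n k → to (iso _ _) (inj₁ (n<1+n n)) }
    copy : ω*·ωShape → Contains (ω* · ω) L
    copy s = strictMono⇒copyIn (ω* · ω) L {P = U} (uncurry point) _
                               (λ { (refl , refl) → Eq.refl }) mono
      where
      open ω*·ωShape s
      mono : uncurry point Preserves StrictTotalOrder._<_ (ω* · ω) ⟶ _<_
      mono (inj₁ n<n′)         = cross n<n′ _ _
      mono (inj₂ (refl , k′<k)) = within _ k′<k

  zShape-of-rich-rows : (s : ω*·ωShape) → let open ω*·ωShape s in
                        Unbounded (λ n → Unbounded (P ∘ point n)) → ZShape P
  zShape-of-rich-rows s rich = record
    { negative          = subchain >-trans (row (term rows 0)) (term∈ rows 0)
    ; positive          = chain (λ j → point (term rows (suc j)) (column j))
                                (λ j → proj₂ (proj₂ (term∈ rows (suc j) 0)))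
                                (λ j → cross (step rows (suc j)) _ _)
    ; negative<positive = λ i j → cross (chain-mono <-trans rows z<s) _ _ }
    where
    open ω*·ωShape s
    rows = unbounded⇒ascending rich
    column : ℕ → ℕ
    column j = proj₁ (term∈ rows (suc j) 0)

  shape-of-descending-above : {T : Pred Carrier p} →
    (∀ {y} → T y → Descending (T ∩ Above y)) → Satisfiable T → ω*·ωShape
  shape-of-descending-above {T = T} above (y₀ , T-y₀) = record
    { point      = λ n → term (row n)
    ; descending = λ n → step (row n)
    ; below-next = λ n k → proj₂ (term∈ (row (suc n)) k) }
    where
    start : ℕ → Σ Carrier T
    start zero    = y₀ , T-y₀
    start (suc n) = let d = above (proj₂ (start n)) in term d 0 , proj₁ (term∈ d 0)
    row : ∀ n → Descending (T ∩ Above (proj₁ (start n)))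
    row n = above (proj₂ (start n))

  shape-of-repeated-cuts : (N : Pred (Pred Carrier ℓ₂) q) →
    (∀ {S} → N S → ∃ λ m → N (S ∩ AtLeast m) × Descending (S ∩ AtMost m)) →
    ∀ {S} → N S → ω*·ωShape
  shape-of-repeated-cuts N cut {S₀} N-S₀ = record
    { point      = λ n → term (row n)
    ; descending = λ n → step (row n)
    ; below-next = below-next }
    where
    stage : ℕ → Σ (Pred Carrier ℓ₂) N
    stage zero    = S₀ , N-S₀
    stage (suc n) = let (S , N-S) = stage n ; (m , N-above , _) = cut N-S
                    in S ∩ AtLeast m , N-above
    cutPoint : ℕ → Carrier
    cutPoint n = proj₁ (cut (proj₂ (stage n)))
    row : ∀ n → Descending (proj₁ (stage n) ∩ AtMost (cutPoint n))
    row n = proj₂ (proj₂ (cut (proj₂ (stage n))))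
    -- row n 0 ≤ cutPoint n ≤ row (suc n) (suc k) < row (suc n) k
    below-next : ∀ n k → term (row n) 0 < term (row (suc n)) k
    below-next n k = ≮-<-trans (proj₂ (term∈ (row n) 0))
      (≮-<-trans (proj₂ (proj₁ (term∈ (row (suc n)) (suc k)))) (step (row (suc n)) k))

  ℤ-arrow⇒ω-arrow : ∀ p → Arrow p L ℤ< ℤ< → Arrow p L ω ω*
  ℤ-arrow⇒ω-arrow p arrow A B partition = Sum.map
    (from (copyIn-ω⇔ascending {P = A}) ∘ ZShape.positive ∘ to copyIn-ℤ⇔zShape)
    (from (copyIn-ω*⇔descending {P = B}) ∘ ZShape.negative ∘ to copyIn-ℤ⇔zShape)
    (arrow A B partition)

module Splitting (lem : ∀ {ℓ} → ExcludedMiddle ℓ)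
                 {c ℓ₁ ℓ₂} (L : StrictTotalOrder c ℓ₁ ℓ₂) where
  open StrictTotalOrder L
  open Shapes L
  open Classical lem

  coloured-shape⇒zShape : ω*·ωShape → {A B : Pred Carrier p} →
                          (∀ x → A x ⊎ B x) → ZShape A ⊎ ZShape B
  coloured-shape⇒zShape s A∪B = Sum.map (zShape-of-rich-rows s) (zShape-of-rich-rows s)
    (unbounded-⊎ λ n → unbounded-⊎ λ k → A∪B (point n k))
    where open ω*·ωShape s

  -- Splittable lives one universe up; deciding it by excluded middle and recording the answer
  -- with True keeps SplitBelow S in the universe of S.
  SplitBelow : Pred Carrier ℓ₂ → Pred Carrier ℓ₂
  SplitBelow S = S ∩ λ y → True (lem {P = Splittable _<_ (S ∩ AtMost y)})

  splittable-splitBelow : ¬ ω*·ωShape → {S : Pred Carrier ℓ₂} → Splittable _<_ (SplitBelow S)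
  splittable-splitBelow ¬shape {S} = dne λ ¬split →
    let T-descending = ¬splittable⇒descending ¬split
    in ¬shape (shape-of-descending-above (descending-above ¬split)
                 (term T-descending 0 , term∈ T-descending 0))
    where
    T = SplitBelow S
    T⊆ : ∀ {y} → T ⊆ (S ∩ AtMost y) ∪ (T ∩ Above y)
    T⊆ {y} {x} T-x with y <? x
    ... | yes y<x = inj₂ (T-x , y<x)
    ... | no  y≮x = inj₁ (proj₁ T-x , y≮x)
    descending-above : ¬ Splittable _<_ T → ∀ {y} → T y → Descending (T ∩ Above y)
    descending-above ¬split (_ , split-below) = ¬splittable⇒descending λ split-above →
      ¬split (splittable-⊆ T⊆ (splittable-∪ trans (toWitness split-below) split-above))

  splittable⇒¬arrow : ∀ p → Splittable _<_ (Poly.U {ℓ = ℓ₂}) → ¬ Arrow p L ω ω*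
  splittable⇒¬arrow p split arrow =
    [ V-noAscending  ∘ chain-map A⊆V ∘ to copyIn-ω⇔ascending
    , W-noDescending ∘ chain-map B⊆W ∘ to copyIn-ω*⇔descending
    ]′ (arrow A B (total , disjoint))
    where
    open Splittable split
    A B : Pred Carrier p
    A x = Lift p (True (lem {P = V x}))
    B x = Lift p (False (lem {P = V x}))
    total : ∀ x → A x ⊎ B x
    total x with lem {P = V x}
    ... | yes _ = inj₁ _
    ... | no  _ = inj₂ _
    disjoint : ∀ x → A x → B x → ⊥
    disjoint x (lift a) (lift b) = toWitnessFalse b (toWitness a)
    A⊆V : A ⊆ V
    A⊆V (lift a) = toWitness a
    B⊆W : B ⊆ W
    B⊆W (lift b) = [ id , ⊥-elim ∘ toWitnessFalse b ]′ (cover tt)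

module Main (lem : ∀ {ℓ} → ExcludedMiddle ℓ)
            {c ℓ₁ ℓ₂} (L : StrictTotalOrder c ℓ₁ ℓ₂) where
  open StrictTotalOrder L
  open Shapes L
  open Splitting lem L
  open Classical lem

  -- The ascending chains and ω*·ω shapes of the reversed order L⁻ are the descending chains
  -- and ω·ω* shapes of L.
  L⁻ : StrictTotalOrder c ℓ₁ ℓ₂
  L⁻ = Flip.strictTotalOrder L

  module Op where
    open Shapes L⁻ public
    open Splitting lem L⁻ public

  zShape-op : Op.ZShape P → ZShape P
  zShape-op z = record
    { negative = positive ; positive = negative ; negative<positive = flip negative<positive }
    where open Op.ZShape z

  contains-ω·ω*⇔contains-op : Contains (ω · ω*) L ⇔ Contains (ω* · ω) L⁻
  contains-ω·ω*⇔contains-op = mk⇔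
    (λ (f , f∈ , iso) → f , f∈ , λ x y → iso y x ⇔-∘ reverse)
    (λ (f , f∈ , iso) → f , f∈ , λ x y → iso y x ⇔-∘ ⇔-sym reverse)
    where
    reverse : ∀ {x y} → StrictTotalOrder._<_ (ω* · ω) x y ⇔ StrictTotalOrder._<_ (ω · ω*) y x
    reverse = mk⇔ (Sum.map₂ (map₁ sym)) (Sum.map₂ (map₁ sym))

  straddle : ¬ ω*·ωShape → ¬ Op.ω*·ωShape → {S : Pred Carrier ℓ₂} → ¬ Splittable _<_ S →
             ∃ λ m → ¬ Splittable _<_ (S ∩ AtMost m) × ¬ Splittable _<_ (S ∩ AtLeast m)
  straddle ¬shape ¬shape⁻ {S} ¬split = dne λ ¬straddle →
    ¬split (splittable-⊆ (cover ¬straddle)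
      (splittable-∪ trans (splittable-splitBelow ¬shape)
                          (splittable-flip (Op.splittable-splitBelow ¬shape⁻))))
    where
    cover : ¬ (∃ λ m → ¬ Splittable _<_ (S ∩ AtMost m) × ¬ Splittable _<_ (S ∩ AtLeast m)) →
            S ⊆ SplitBelow S ∪ Op.SplitBelow S
    cover ¬straddle {x} S-x
      with lem {P = Splittable _<_ (S ∩ AtMost x)}
         | lem {P = Splittable (flip _<_) (S ∩ Op.AtMost x)}
    ... | yes _     | _         = inj₁ (S-x , _)
    ... | no _      | yes _     = inj₂ (S-x , _)
    ... | no ¬below | no ¬above = ⊥-elim (¬straddle (x , ¬below , ¬above ∘ splittable-flip))

  splittable-whole : ¬ ω*·ωShape → ¬ Op.ω*·ωShape → Splittable _<_ (Poly.U {ℓ = ℓ₂})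
  splittable-whole ¬shape ¬shape⁻ = dne λ ¬split →
    ¬shape (shape-of-repeated-cuts (¬_ ∘ Splittable _<_) cut ¬split)
    where
    cut : ∀ {S} → ¬ Splittable _<_ S →
          ∃ λ m → ¬ Splittable _<_ (S ∩ AtLeast m) × Descending (S ∩ AtMost m)
    cut ¬split =
      let (m , ¬below , ¬above) = straddle ¬shape ¬shape⁻ ¬split
      in m , ¬above , ¬splittable⇒descending ¬below

  contains⇒ℤ-arrow : ∀ p → Contains (ω · ω*) L ⊎ Contains (ω* · ω) L → Arrow p L ℤ< ℤ<
  contains⇒ℤ-arrow p (inj₁ ω·ω*⊆L) A B (A∪B , _) =
    Sum.map (from copyIn-ℤ⇔zShape ∘ zShape-op) (from copyIn-ℤ⇔zShape ∘ zShape-op)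
      (Op.coloured-shape⇒zShape
        (to Op.contains-ω*·ω⇔ω*·ωShape (to contains-ω·ω*⇔contains-op ω·ω*⊆L)) A∪B)
  contains⇒ℤ-arrow p (inj₂ ω*·ω⊆L) A B (A∪B , _) =
    Sum.map (from copyIn-ℤ⇔zShape) (from copyIn-ℤ⇔zShape)
      (coloured-shape⇒zShape (to contains-ω*·ω⇔ω*·ωShape ω*·ω⊆L) A∪B)

  ω-arrow⇒contains : ∀ p → Arrow p L ω ω* → Contains (ω · ω*) L ⊎ Contains (ω* · ω) L
  ω-arrow⇒contains p arrow = dne λ neither → splittable⇒¬arrow p
    (splittable-whole (neither ∘ inj₂ ∘ from contains-ω*·ω⇔ω*·ωShape)
                      (neither ∘ inj₁ ∘ from contains-ω·ω*⇔contains-op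
                                      ∘ from Op.contains-ω*·ω⇔ω*·ωShape))
    arrow

mainTheorem2 : (lem : ∀ {ℓ} → ExcludedMiddle ℓ) →
    ∀ {c ℓ₁ ℓ₂ : Level} (p : Level) (L : StrictTotalOrder c ℓ₁ ℓ₂) →
      (Arrow p L ℤ< ℤ< ⇔ Arrow p L ω ω*) ×
      (Arrow p L ω ω* ⇔ (Contains (ω · ω*) L ⊎ Contains (ω* · ω) L))
mainTheorem2 lem p L =
  mk⇔ (ℤ-arrow⇒ω-arrow p) (contains⇒ℤ-arrow p ∘ ω-arrow⇒contains p) ,
  mk⇔ (ω-arrow⇒contains p) (ℤ-arrow⇒ω-arrow p ∘ contains⇒ℤ-arrow p)
  where
  open Shapes L using (ℤ-arrow⇒ω-arrow)
  open Main lem L using (contains⇒ℤ-arrow; ω-arrow⇒contains)
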